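{- Let $[x]t$ be a normal planar lambda term with one free variable and with $R$-coloring $\pi$. Then exactly one of the following holds: (i) $t=x$ (the identity term) and $|\pi|=|\mathrm{ONH}(\pi)|=1$; (ii) $[x]t=\mathrm{FO}([x_1]t_1,[x_2]t_2)$ for some normal planar terms $[x_1]t_1,[x_2]t_2$ with $R$-colorings $\pi_1,\pi_2$ such that $|\pi|=|\pi_1|+|\pi_2|$ and $|\mathrm{ONH}(\pi)|=1+|\mathrm{ONH}(\pi_1)|+|\mathrm{ONH}(\pi_2)|$; (iii) $[x]t=\mathrm{VO}_k([x_1]t_1)$ for some normal planar term $[x_1]t_1$ with $R$-coloring $\pi_1$ and some $1\le k\le|\mathrm{ONH}(\pi_1)|$, such that $|\pi|=1+|\pi_1|$ and $|\mathrm{ONH}(\pi)|=k+1$.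
   Context: Lambda skeletons: graded sets $\Lambda(i)$, least such that $\_\in\Lambda(1)$; $p\in\Lambda(j),q\in\Lambda(k)\Rightarrow p(q)\in\Lambda(j+k)$; $p\in\Lambda(i+1)\Rightarrow\lambda\_.p\in\Lambda(i)$. Planar lambda terms $[\Gamma]t$ ($\Gamma$ a list of free variables) decorating skeletons: $[x]x$ decorates $\_$; if $[\Gamma]t$ decorates $p$ and $[\Delta]u$ decorates $q$ then $[\Gamma,\Delta]t(u)$ decorates $p(q)$; if $[x,\Gamma]t$ decorates $p$ then $[\Gamma]\lambda x.t$ decorates $\lambda\_.p$; terms modulo $\alpha$-equivalence. Colorings: rules $v$: $\_\in\Lambda_B(1)$; $a$: $p\in\Lambda_B(j),q\in\Lambda_R(k)\Rightarrow p(q)\in\Lambda_B(j+k)$; $s$: $p\in\Lambda_B(i)\Rightarrow p\in\Lambda_R(i)$; $\ell$: $p\in\Lambda_R(i+1)\Rightarrow\lambda\_.p\in\Lambda_R(i)$. A $B$-coloring ($R$-coloring) of a term is a derivation of its skeleton in $\Lambda_B$ ($\Lambda_R$); normal means having an $R$-coloring, neutral means having a $B$-coloring; size $|\pi|$ is the number of uses of $s$. Outer neutral handles: a neutral handle is an occurrence of a neutral subterm (given by a $B$-colored subderivation); the ordered list $\mathrm{ONH}(\pi)$ is defined inductively: for rule $v$ on $[x]x$, $\mathrm{ONH}=(x)$; for rule $a$ from $\pi_1$ (for $[\Gamma]t$) and $\pi_2$ (for $[\Delta]u$): the whole $t(u)$, then the handles of $\pi_2$ inside $u$, then, only if $\Delta$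 is empty, the handles of $\pi_1$ inside $t$; for $s$ or $\ell$ with premise $\pi_1$: the handles of $\pi_1$. Operations: $\mathrm{FO}([x_1]t_1,[x_2]t_2)=[x]\,t_1[x(\lambda x_2.t_2)/x_1]$, i.e. the occurrence of $x_1$ in $t_1$ is replaced by $x(\lambda x_2.t_2)$ (with $x$ fresh). $\mathrm{VO}_k([x_1]t_1)$: write $t_1=C[n]$ where $n$ is the neutral subterm at the $k$-th outer neutral handle of $t_1$; then $\mathrm{VO}_k([x_1]t_1)=[x]\lambda x_1.C[n(x)]$ with $x$ fresh. -}

module Defs where

open import Data.Nat using (ℕ; zero; suc; _+_)
open import Data.Nat.Properties using (+-comm; +-suc)
open import Data.Fin using (Fin; zero; suc; splitAt)
open import Data.Sum using (inj₁; inj₂)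
open import Data.List using (List; []; _∷_; _++_; map)
open import Data.Maybe using (Maybe; just; nothing; _>>=_) renaming (map to mapMaybe)
open import Relation.Binary.PropositionalEquality using (subst)

-- Lambda skeletons Λ(i), i = number of free variables.
-- A planar lambda term [Γ]t modulo α is determined by the skeleton it
-- decorates (Γ = free variables in left-to-right order of occurrence,
-- each λ binds the leftmost free variable of its body), so we use the
-- intrinsically-scoped representation: Tm i ≅ planar terms with i free
-- variables modulo α.

data Tm : ℕ → Set where
  var : Tm 1
  app : {j k : ℕ} → Tm j → Tm k → Tm (j + k)
  lam : {i : ℕ} → Tm (suc i) → Tm i                 -- [Γ]λx.t from [x,Γ]t

-- Colorings: B-colorings (neutral) and R-colorings (normal).

mutual
  data B : {i : ℕ} → Tm i → Set where
    v : B var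
    a : {j k : ℕ} {p : Tm j} {q : Tm k} → B p → R q → B (app p q)

  data R : {i : ℕ} → Tm i → Set where
    s : {i : ℕ} {p : Tm i} → B p → R p
    ℓ : {i : ℕ} {p : Tm (suc i)} → R p → R (lam p)

mutual
  sizeB : {i : ℕ} {t : Tm i} → B t → ℕ
  sizeB v = 0
  sizeB (a π₁ π₂) = sizeB π₁ + sizeR π₂

  sizeR : {i : ℕ} {t : Tm i} → R t → ℕ
  sizeR (s π) = suc (sizeB π)
  sizeR (ℓ π) = sizeR π

-- Occurrences of subterms: paths from the root.

data Dir : Set where
  fun arg body : Dir

Path : Set
Path = List Dir

-- "only if Δ is empty": keep the list iff the argument has 0 free vars
ifEmptyCtx : ℕ → List Path → List Path
ifEmptyCtx zero    ps = ps
ifEmptyCtx (suc _) ps = []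

-- Outer neutral handles ONH(π), as an ordered list of occurrences.
mutual
  onhB : {i : ℕ} {t : Tm i} → B t → List Path
  onhB v = [] ∷ []
  onhB (a {k = k} π₁ π₂) =
    [] ∷ (map (arg ∷_) (onhR π₂) ++ ifEmptyCtx k (map (fun ∷_) (onhB π₁)))

  onhR : {i : ℕ} {t : Tm i} → R t → List Path
  onhR (s π) = onhB π
  onhR (ℓ π) = map (body ∷_) (onhR π)

-- FO([x₁]t₁,[x₂]t₂) = [x] t₁[x(λx₂.t₂)/x₁].
-- substVar t f u : replace the f-th free variable (left-to-right) of t
-- by a term u with one free variable (the context length is unchanged).

substVar : {i : ℕ} → Tm i → Fin i → Tm 1 → Tm i
substVar var zero u = u
substVar (app {j} {k} p q) f u with splitAt j f
... | inj₁ f₁ = app (substVar p f₁ u) q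
... | inj₂ f₂ = app p (substVar q f₂ u)
substVar (lam p) f u = lam (substVar p (suc f) u)

FO : Tm 1 → Tm 1 → Tm 1
FO t₁ t₂ = substVar t₁ zero (app var (lam t₂))

-- VO_k([x₁]t₁) = [x] λx₁. C[n(x)], n the k-th outer neutral handle.
-- appendAt path t replaces the subterm n at `path` by n(x), x fresh.
-- (Nothing if the path is not an occurrence in t.)

appendAt : {i : ℕ} → Path → Tm i → Maybe (Tm (suc i))
appendAt {i} [] t = just (subst Tm (+-comm i 1) (app t var))
appendAt (fun ∷ ps) (app p q) = mapMaybe (λ p′ → app p′ q) (appendAt ps p)
appendAt (arg ∷ ps) (app {j} {k} p q) =
  mapMaybe (λ q′ → subst Tm (+-suc j k) (app p q′)) (appendAt ps q)
appendAt (body ∷ ps) (lam p) = mapMaybe lam (appendAt ps p)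
appendAt _ _ = nothing

-- k-th element, 1-indexed
nth₁ : {A : Set} → ℕ → List A → Maybe A
nth₁ _ [] = nothing
nth₁ zero (x ∷ xs) = nothing
nth₁ (suc zero) (x ∷ xs) = just x
nth₁ (suc (suc k)) (x ∷ xs) = nth₁ (suc k) xs

-- VO_k([x₁]t₁), relative to the R-coloring π₁ of t₁ (which determines ONH)
VO : (k : ℕ) {t₁ : Tm 1} → R t₁ → Maybe (Tm 1)
VO k {t₁} π₁ = nth₁ k (onhR π₁) >>= λ n → mapMaybe lam (appendAt n t₁)

module Submission where

-- Idea: look at the LAST free variable.  Every coloured term with a free
-- variable, neutral (B) or normal (R), is either the variable itself, or its last
-- variable is applied to a closed normal term λx₂.t₂ (an FO split: plug
-- x(λx₂.t₂) into the last variable of a smaller t₁), or its last variable is the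
-- argument of n(x) with n an outer neutral handle of a smaller term t₀ (a VO
-- split).  This decomposition (`decB`/`decR`) is computed by one mutual
-- recursion on colourings, keeping track of sizes and handle counts; the
-- theorem applies it to π (if π ends with s) or to the body of the outer λ
-- (if π ends with ℓ).  The cases exclude each other by two invariants: FO never
-- yields a variable, and `lastIsArg` (the last variable is an argument) fails
-- for the identity and for FO, but holds for VO.

open import Defs
open import Data.Nat using (ℕ; zero; suc; _+_; _≤_; z≤n; s≤s)
open import Data.Nat.Properties
  using (+-comm; +-suc; +-assoc; +-identityʳ; +-cancelˡ-≡; m≤m+n; ≤-trans; m+1+n≰m)
open import Data.Nat.Tactic.RingSolver using (solve-∀)
open import Data.Bool using (Bool; true; false; _∨_)
open import Data.Bool.Properties using (∨-zeroʳ)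
open import Data.List using (List; []; _∷_; _++_; map; length)
open import Data.List.Properties using (length-map; length-++; ++-identityʳ)
open import Data.List.Relation.Unary.All using (All; []; _∷_)
open import Data.List.Relation.Unary.All.Properties using (++⁺; gmap⁺)
open import Data.Maybe using (Maybe; just; nothing; _>>=_) renaming (map to mapMaybe)
import Data.Maybe.Relation.Unary.All as Maybe
open import Data.Maybe.Relation.Unary.All.Properties using (gmap)
open import Data.Fin using (Fin; zero; suc; toℕ; splitAt)
open import Data.Fin.Properties using (toℕ-↑ˡ; toℕ-↑ʳ; toℕ<n; splitAt⁻¹-↑ˡ; splitAt⁻¹-↑ʳ)
open import Data.Product using (Σ; _×_; ∃-syntax; _,_)
open import Data.Sum using (_⊎_; inj₁; inj₂)
open import Data.Empty using (⊥-elim)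
open import Function using (id)
open import Relation.Nullary using (¬_)
open import Relation.Binary.PropositionalEquality
  using (_≡_; refl; sym; trans; cong; cong₂; subst; module ≡-Reasoning)

open ≡-Reasoning

-- 0-indexed partial lookup; the 1-indexed `nth₁` of the definitions is a shift of it.
at : {A : Set} → ℕ → List A → Maybe A
at _       []       = nothing
at zero    (x ∷ xs) = just x
at (suc n) (x ∷ xs) = at n xs

nth₁-suc : {A : Set} (n : ℕ) (xs : List A) → nth₁ (suc n) xs ≡ at n xs
nth₁-suc n       []       = refl
nth₁-suc zero    (x ∷ xs) = refl
nth₁-suc (suc n) (x ∷ xs) = nth₁-suc n xs

at-map : {A B : Set} (f : A → B) (n : ℕ) (xs : List A) → at n (map f xs) ≡ mapMaybe f (at n xs)
at-map f n       []       = refl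
at-map f zero    (x ∷ xs) = refl
at-map f (suc n) (x ∷ xs) = at-map f n xs

at-++ʳ : {A : Set} (xs ys : List A) (n : ℕ) → at (length xs + n) (xs ++ ys) ≡ at n ys
at-++ʳ []       ys n = refl
at-++ʳ (x ∷ xs) ys n = at-++ʳ xs ys n

at-++ˡ : {A : Set} (xs ys : List A) (n : ℕ) {y : A} → at n xs ≡ just y → at n (xs ++ ys) ≡ just y
at-++ˡ (x ∷ xs) ys zero    found = found
at-++ˡ (x ∷ xs) ys (suc n) found = at-++ˡ xs ys n found

at-length : {A : Set} (n : ℕ) (xs : List A) {y : A} → at n xs ≡ just y → suc n ≤ length xs
at-length zero    (x ∷ xs) found = s≤s z≤n
at-length (suc n) (x ∷ xs) found = s≤s (at-length n xs found)

All-nth₁ : {A : Set} {P : A → Set} (k : ℕ) {xs : List A} {y : A} →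
  All P xs → nth₁ k xs ≡ just y → P y
All-nth₁ (suc zero)    (py ∷ _)   refl  = py
All-nth₁ (suc (suc k)) (_  ∷ pxs) found = All-nth₁ (suc k) pxs found

+-rightComm : ∀ m n o → (m + n) + o ≡ (m + o) + n
+-rightComm = solve-∀

+-suc-assoc : ∀ l m n → l + suc (m + n) ≡ suc (l + m) + n
+-suc-assoc = solve-∀

+-suc-suc : ∀ m n → m + suc (suc n) ≡ suc (suc (m + n))
+-suc-suc = solve-∀

neutral-open : ∀ {i} {t : Tm i} → B t → 1 ≤ i
neutral-open v = s≤s z≤n
neutral-open (a {j} {k} β _) = ≤-trans (neutral-open β) (m≤m+n j k)

no-closed-neutral : {t : Tm 0} → ¬ B t
no-closed-neutral β with neutral-open β
... | ()

at-root : ∀ {i} {t : Tm i} (β : B t) → at 0 (onhB β) ≡ just []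
at-root v       = refl
at-root (a _ _) = refl

onh-closedArg : ∀ {j} {p : Tm j} {q : Tm 0} (β : B p) (ρ : R q) →
  length (onhB (a β ρ)) ≡ suc (length (onhR ρ) + length (onhB β))
onh-closedArg β ρ = cong suc (begin
  length (map (arg ∷_) (onhR ρ) ++ map (fun ∷_) (onhB β))
    ≡⟨ length-++ (map (arg ∷_) (onhR ρ)) ⟩
  length (map (arg ∷_) (onhR ρ)) + length (map (fun ∷_) (onhB β))
    ≡⟨ cong₂ _+_ (length-map (arg ∷_) (onhR ρ)) (length-map (fun ∷_) (onhB β)) ⟩
  length (onhR ρ) + length (onhB β) ∎)

onh-openArg : ∀ {j k} {p : Tm j} {q : Tm (suc k)} (β : B p) (ρ : R q) →
  length (onhB (a β ρ)) ≡ suc (length (onhR ρ))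
onh-openArg β ρ = cong suc (begin
  length (map (arg ∷_) (onhR ρ) ++ []) ≡⟨ cong length (++-identityʳ (map (arg ∷_) (onhR ρ))) ⟩
  length (map (arg ∷_) (onhR ρ))       ≡⟨ length-map (arg ∷_) (onhR ρ) ⟩
  length (onhR ρ)                      ∎)

onh-lam : ∀ {i} {p : Tm (suc i)} (ρ : R p) → length (onhR (ℓ ρ)) ≡ length (onhR ρ)
onh-lam ρ = length-map (body ∷_) (onhR ρ)

-- PlugLast u t t′ : t′ is t with its last free variable replaced by u.
-- It follows the path to that variable: into the function when the argument
-- is closed, into the argument otherwise, and under λ while variables remain.
data PlugLast (u : Tm 1) : ∀ {i} → Tm i → Tm i → Set where
  here : PlugLast u var u
  fun  : ∀ {j} {p p′ : Tm j} {q : Tm 0} → PlugLast u p p′ → PlugLast u (app p q) (app p′ q)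
  arg  : ∀ {j k} {p : Tm j} {q q′ : Tm (suc k)} → PlugLast u q q′ → PlugLast u (app p q) (app p q′)
  body : ∀ {i} {p p′ : Tm (suc (suc i))} → PlugLast u p p′ → PlugLast u (lam p) (lam p′)

plugLast-unique : ∀ {u i} {t t₁ t₂ : Tm i} → PlugLast u t t₁ → PlugLast u t t₂ → t₁ ≡ t₂
plugLast-unique here      here      = refl
plugLast-unique (fun p₁)  (fun p₂)  = cong (λ f → app f _) (plugLast-unique p₁ p₂)
plugLast-unique (arg p₁)  (arg p₂)  = cong (app _) (plugLast-unique p₁ p₂)
plugLast-unique (body p₁) (body p₂) = cong lam (plugLast-unique p₁ p₂)

IsLast : ∀ {i} → Fin i → Set
IsLast {i} f = suc (toℕ f) ≡ i

splitAt-left-toℕ : ∀ {j k} {f : Fin (j + k)} {f₁ : Fin j} →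
  splitAt j f ≡ inj₁ f₁ → toℕ f ≡ toℕ f₁
splitAt-left-toℕ {k = k} {f₁ = f₁} split =
  trans (cong toℕ (sym (splitAt⁻¹-↑ˡ split))) (toℕ-↑ˡ f₁ k)

splitAt-right-toℕ : ∀ {j k} {f : Fin (j + k)} {f₂ : Fin k} →
  splitAt j f ≡ inj₂ f₂ → toℕ f ≡ j + toℕ f₂
splitAt-right-toℕ {j} {f₂ = f₂} split =
  trans (cong toℕ (sym (splitAt⁻¹-↑ʳ split))) (toℕ-↑ʳ j f₂)

substVar-plugLast : ∀ {i} (t : Tm i) (f : Fin i) (u : Tm 1) → IsLast f → PlugLast u t (substVar t f u)
substVar-plugLast var zero u _ = here
substVar-plugLast (app {j} {zero} p q) f u last with splitAt j f in split
... | inj₁ f₁ = fun (substVar-plugLast p f₁ u (begin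
  suc (toℕ f₁) ≡⟨ cong suc (sym (splitAt-left-toℕ split)) ⟩
  suc (toℕ f)  ≡⟨ last ⟩
  j + 0        ≡⟨ +-identityʳ j ⟩
  j            ∎))
substVar-plugLast (app {j} {suc k} p q) f u last with splitAt j f in split
... | inj₁ f₁ = ⊥-elim (m+1+n≰m j (subst (_≤ j) lastInΓ (toℕ<n f₁)))
  where
  lastInΓ : suc (toℕ f₁) ≡ j + suc k
  lastInΓ = trans (cong suc (sym (splitAt-left-toℕ split))) last
... | inj₂ f₂ = arg (substVar-plugLast q f₂ u (+-cancelˡ-≡ j _ _ (begin
  j + suc (toℕ f₂) ≡⟨ +-suc j (toℕ f₂) ⟩
  suc (j + toℕ f₂) ≡⟨ cong suc (sym (splitAt-right-toℕ split)) ⟩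
  suc (toℕ f)      ≡⟨ last ⟩
  j + suc k        ∎)))
substVar-plugLast (lam {suc i} p) f u last = body (substVar-plugLast p (suc f) u (cong suc last))

plugLast-FO : ∀ {t₁ t₂ t : Tm 1} → PlugLast (app var (lam t₂)) t₁ t → t ≡ FO t₁ t₂
plugLast-FO {t₁} plug = plugLast-unique plug (substVar-plugLast t₁ zero _ refl)

isVar : ∀ {i} → Tm i → Bool
isVar var       = true
isVar (app _ _) = false
isVar (lam _)   = false

lastIsArg : ∀ {i} → Tm i → Bool
lastIsArg var                   = false
lastIsArg (app {k = zero}  p q) = lastIsArg p
lastIsArg (app {k = suc _} p q) = isVar q ∨ lastIsArg q
lastIsArg (lam {zero}  p)       = false
lastIsArg (lam {suc _} p)       = lastIsArg p

lastIsArg-subst : ∀ {i j} (e : i ≡ j) (t : Tm i) → lastIsArg (subst Tm e t) ≡ lastIsArg t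
lastIsArg-subst refl t = refl

plugLast-isVar : ∀ {u i} {t t′ : Tm i} → isVar u ≡ false → PlugLast u t t′ → isVar t′ ≡ false
plugLast-isVar notVar here     = notVar
plugLast-isVar notVar (fun _)  = refl
plugLast-isVar notVar (arg _)  = refl
plugLast-isVar notVar (body _) = refl

plugLast-lastIsArg : ∀ {u i} {t t′ : Tm i} → isVar u ≡ false → lastIsArg u ≡ false →
  PlugLast u t t′ → lastIsArg t′ ≡ false
plugLast-lastIsArg notVar notArg here        = notArg
plugLast-lastIsArg notVar notArg (fun plug)  = plugLast-lastIsArg notVar notArg plug
plugLast-lastIsArg notVar notArg (arg plug)  =
  cong₂ _∨_ (plugLast-isVar notVar plug) (plugLast-lastIsArg notVar notArg plug)
plugLast-lastIsArg notVar notArg (body plug) = plugLast-lastIsArg notVar notArg plug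

FO-isVar : (t₁ t₂ : Tm 1) → isVar (FO t₁ t₂) ≡ false
FO-isVar t₁ t₂ = plugLast-isVar refl (substVar-plugLast t₁ zero _ refl)

FO-lastIsArg : (t₁ t₂ : Tm 1) → lastIsArg (FO t₁ t₂) ≡ false
FO-lastIsArg t₁ t₂ = plugLast-lastIsArg refl refl (substVar-plugLast t₁ zero _ refl)

record AppendsArg {i} (t : Tm i) (ps : Path) : Set where
  constructor appendsArg
  field isArg : Maybe.All (λ t′ → lastIsArg t′ ≡ true) (appendAt ps t)

appendsArg-root : ∀ {i} (t : Tm i) → AppendsArg t []
appendsArg-root {i} t = appendsArg (Maybe.just (lastIsArg-subst (+-comm i 1) (app t var)))

appendsArg-fun : ∀ {j} {p : Tm j} {q : Tm 0} {ps : Path} →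
  AppendsArg p ps → AppendsArg (app p q) (fun ∷ ps)
appendsArg-fun (appendsArg isArg) = appendsArg (gmap id isArg)

appendsArg-arg : ∀ {j k} {p : Tm j} {q : Tm k} {ps : Path} →
  AppendsArg q ps → AppendsArg (app p q) (arg ∷ ps)
appendsArg-arg {j} {k} {p} (appendsArg isArg) = appendsArg (gmap underApp isArg)
  where
  underApp : ∀ {q′ : Tm (suc k)} →
    lastIsArg q′ ≡ true → lastIsArg (subst Tm (+-suc j k) (app p q′)) ≡ true
  underApp {q′} isArg′ = begin
    lastIsArg (subst Tm (+-suc j k) (app p q′)) ≡⟨ lastIsArg-subst (+-suc j k) (app p q′) ⟩
    isVar q′ ∨ lastIsArg q′                     ≡⟨ cong (isVar q′ ∨_) isArg′ ⟩
    isVar q′ ∨ true                             ≡⟨ ∨-zeroʳ (isVar q′) ⟩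
    true                                        ∎

appendsArg-body : ∀ {i} {p : Tm (suc i)} {ps : Path} →
  AppendsArg p ps → AppendsArg (lam p) (body ∷ ps)
appendsArg-body (appendsArg isArg) = appendsArg (gmap id isArg)

-- Every outer neutral handle is such an occurrence: the handles only enter the
-- function part of an application whose argument is closed.
mutual
  onhB-appendsArg : ∀ {i} {t : Tm i} (β : B t) → All (AppendsArg t) (onhB β)
  onhB-appendsArg v = appendsArg-root var ∷ []
  onhB-appendsArg (a {k = zero} {p} {q} β ρ) = appendsArg-root (app p q) ∷
    ++⁺ (gmap⁺ appendsArg-arg (onhR-appendsArg ρ))
        (gmap⁺ appendsArg-fun (onhB-appendsArg β))
  onhB-appendsArg (a {k = suc _} {p} {q} β ρ) = appendsArg-root (app p q) ∷
    ++⁺ (gmap⁺ appendsArg-arg (onhR-appendsArg ρ)) []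

  onhR-appendsArg : ∀ {i} {t : Tm i} (ρ : R t) → All (AppendsArg t) (onhR ρ)
  onhR-appendsArg (s β) = onhB-appendsArg β
  onhR-appendsArg (ℓ ρ) = gmap⁺ appendsArg-body (onhR-appendsArg ρ)

VO-lastIsArg : (k : ℕ) {t₁ t : Tm 1} (π₁ : R t₁) → VO k π₁ ≡ just t → lastIsArg t ≡ true
VO-lastIsArg k {t₁} π₁ vo with nth₁ k (onhR π₁) in found | vo
... | nothing | ()
... | just ps | vo′
  with appendAt ps t₁ | AppendsArg.isArg (All-nth₁ k (onhR-appendsArg π₁) found) | vo′
...   | just p  | Maybe.just isArg | refl = isArg
...   | nothing | _                | ()

-- The possible shapes of a coloured term at its last free variable, stated
-- uniformly for both kinds of colouring C (B or R) with their size, handle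
-- list, and colouring of the variable.
module Decomposition
  (C    : ∀ {i} → Tm i → Set)
  (size : ∀ {i} {t : Tm i} → C t → ℕ)
  (onh  : ∀ {i} {t : Tm i} → C t → List Path)
  (axiom : C var) where

  record FOSplit {i} {t : Tm i} (γ : C t) : Set where
    constructor foSplit
    field
      t₁     : Tm i
      t₂     : Tm 1
      γ₁     : C t₁
      π₂     : R t₂
      plug   : PlugLast (app var (lam t₂)) t₁ t
      size-≡ : size γ ≡ size γ₁ + sizeR π₂
      onh-≡  : length (onh γ) ≡ suc (length (onh γ₁) + length (onhR π₂))

  -- t is t₀ with a fresh last variable appended at its handle number k₀ (0-indexed).
  record VOSplit {i} {t : Tm i} (γ : C t) : Set where
    constructor voSplit
    field
      {i₀}    : ℕ
      grow    : i ≡ suc i₀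
      t₀      : Tm i₀
      γ₀      : C t₀
      handle  : Path
      k₀      : ℕ
      handle∈ : at k₀ (onh γ₀) ≡ just handle
      append  : appendAt handle t₀ ≡ just (subst Tm grow t)
      size-≡  : size γ ≡ suc (size γ₀)
      onh-≡   : length (onh γ) ≡ suc (suc k₀)

  data Shape : ∀ {i} {t : Tm i} → C t → Set where
    identity : Shape axiom
    fo       : ∀ {i} {t : Tm i} {γ : C t} → FOSplit γ → Shape γ
    vo       : ∀ {i} {t : Tm i} {γ : C t} → VOSplit γ → Shape γ

module ShapeB = Decomposition B sizeB onhB v
module ShapeR = Decomposition R sizeR onhR (s v)
open ShapeB using (identity; fo; vo; foSplit; voSplit)
open ShapeR using ()
  renaming (identity to identityᴿ; fo to foᴿ; vo to voᴿ; foSplit to foSplitᴿ; voSplit to voSplitᴿ)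

-- Application to a closed argument λx₂.t₂: the last variable lies in the function.
closedArg : ∀ {j} {p : Tm j} {t₂ : Tm 1} (β : B p) (π₂ : R t₂) →
  ShapeB.Shape β → ShapeB.Shape (a β (ℓ π₂))
closedArg β π₂ identity = fo (foSplit var _ v π₂ here refl (begin
  length (onhB (a v (ℓ π₂)))     ≡⟨ onh-closedArg v (ℓ π₂) ⟩
  suc (length (onhR (ℓ π₂)) + 1) ≡⟨ cong (λ n → suc (n + 1)) (onh-lam π₂) ⟩
  suc (length (onhR π₂) + 1)     ≡⟨ cong suc (+-comm (length (onhR π₂)) 1) ⟩
  suc (1 + length (onhR π₂))     ∎))
closedArg {t₂ = t₂} β π₂ (fo (foSplit t₁ t₂′ γ₁ π₂′ plug size-≡ onh-≡)) =
  fo (foSplit (app t₁ (lam t₂)) t₂′ (a γ₁ (ℓ π₂)) π₂′ (fun plug) size-≡′ onh-≡′)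
  where
  size-≡′ : sizeB β + sizeR π₂ ≡ (sizeB γ₁ + sizeR π₂) + sizeR π₂′
  size-≡′ = trans (cong (_+ sizeR π₂) size-≡) (+-rightComm (sizeB γ₁) (sizeR π₂′) (sizeR π₂))
  L : ℕ
  L = length (onhR (ℓ π₂))
  onh-≡′ : length (onhB (a β (ℓ π₂))) ≡ suc (length (onhB (a γ₁ (ℓ π₂))) + length (onhR π₂′))
  onh-≡′ = begin
    length (onhB (a β (ℓ π₂)))
      ≡⟨ onh-closedArg β (ℓ π₂) ⟩
    suc (L + length (onhB β))
      ≡⟨ cong (λ n → suc (L + n)) onh-≡ ⟩
    suc (L + suc (length (onhB γ₁) + length (onhR π₂′)))
      ≡⟨ cong suc (+-suc-assoc L (length (onhB γ₁)) (length (onhR π₂′))) ⟩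
    suc (suc (L + length (onhB γ₁)) + length (onhR π₂′))
      ≡⟨ cong (λ n → suc (n + length (onhR π₂′))) (sym (onh-closedArg γ₁ (ℓ π₂))) ⟩
    suc (length (onhB (a γ₁ (ℓ π₂))) + length (onhR π₂′)) ∎
closedArg {p = p} {t₂} β π₂ (vo (voSplit grow t₀ β₀ handle k₀ handle∈ append size-≡ onh-≡)) =
  vo (voSplit (cong (_+ 0) grow) (app t₀ (lam t₂)) (a β₀ (ℓ π₂)) (fun ∷ handle) (suc (L + k₀))
              handle∈′ append′ (cong (_+ sizeR π₂) size-≡) onh-≡′)
  where
  -- the handles of the argument come before those of the function
  args : List Path
  args = map (arg ∷_) (onhR (ℓ π₂))
  L : ℕ
  L = length args
  handle∈′ : at (suc (L + k₀)) (onhB (a β₀ (ℓ π₂))) ≡ just (fun ∷ handle)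
  handle∈′ = begin
    at (L + k₀) (args ++ map (fun ∷_) (onhB β₀)) ≡⟨ at-++ʳ args _ k₀ ⟩
    at k₀ (map (fun ∷_) (onhB β₀))               ≡⟨ at-map (fun ∷_) k₀ (onhB β₀) ⟩
    mapMaybe (fun ∷_) (at k₀ (onhB β₀))          ≡⟨ cong (mapMaybe (fun ∷_)) handle∈ ⟩
    just (fun ∷ handle)                          ∎
  subst-app : ∀ {m n} (e : m ≡ n) (f : Tm m) →
    app (subst Tm e f) (lam t₂) ≡ subst Tm (cong (_+ 0) e) (app f (lam t₂))
  subst-app refl f = refl
  append′ : appendAt (fun ∷ handle) (app t₀ (lam t₂)) ≡
            just (subst Tm (cong (_+ 0) grow) (app p (lam t₂)))
  append′ = begin
    mapMaybe (λ f → app f (lam t₂)) (appendAt handle t₀)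
      ≡⟨ cong (mapMaybe (λ f → app f (lam t₂))) append ⟩
    just (app (subst Tm grow p) (lam t₂))
      ≡⟨ cong just (subst-app grow p) ⟩
    just (subst Tm (cong (_+ 0) grow) (app p (lam t₂))) ∎
  onh-≡′ : length (onhB (a β (ℓ π₂))) ≡ suc (suc (suc (L + k₀)))
  onh-≡′ = begin
    length (onhB (a β (ℓ π₂)))
      ≡⟨ onh-closedArg β (ℓ π₂) ⟩
    suc (length (onhR (ℓ π₂)) + length (onhB β))
      ≡⟨ cong₂ (λ m n → suc (m + n)) (sym (length-map (arg ∷_) (onhR (ℓ π₂)))) onh-≡ ⟩
    suc (L + suc (suc k₀))
      ≡⟨ cong suc (+-suc-suc L k₀) ⟩
    suc (suc (suc (L + k₀))) ∎

-- Application to an argument with free variables: the last variable lies in the argument.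
openArg : ∀ {j k} {p : Tm j} {q : Tm (suc k)} (β : B p) (ρ : R q) →
  ShapeR.Shape ρ → ShapeB.Shape (a β ρ)
openArg {j} {p = p} β .(s v) identityᴿ =
  vo (voSplit (+-comm j 1) p β [] 0 (at-root β) refl (+-comm (sizeB β) 1) refl)
openArg {p = p} β ρ (foᴿ (foSplitᴿ t₁ t₂ γ₁ π₂ plug size-≡ onh-≡)) =
  fo (foSplit (app p t₁) t₂ (a β γ₁) π₂ (arg plug) size-≡′ onh-≡′)
  where
  size-≡′ : sizeB β + sizeR ρ ≡ (sizeB β + sizeR γ₁) + sizeR π₂
  size-≡′ = trans (cong (sizeB β +_) size-≡) (sym (+-assoc (sizeB β) (sizeR γ₁) (sizeR π₂)))
  onh-≡′ : length (onhB (a β ρ)) ≡ suc (length (onhB (a β γ₁)) + length (onhR π₂))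
  onh-≡′ = begin
    length (onhB (a β ρ))
      ≡⟨ onh-openArg β ρ ⟩
    suc (length (onhR ρ))
      ≡⟨ cong suc onh-≡ ⟩
    suc (suc (length (onhR γ₁)) + length (onhR π₂))
      ≡⟨ cong (λ n → suc (n + length (onhR π₂))) (sym (onh-openArg β γ₁)) ⟩
    suc (length (onhB (a β γ₁)) + length (onhR π₂)) ∎
openArg {j} {k} {p} β ρ (voᴿ (voSplitᴿ refl t₀ ρ₀ handle k₀ handle∈ append size-≡ onh-≡)) =
  vo (voSplit (+-suc j k) (app p t₀) (a β ρ₀) (arg ∷ handle) (suc k₀) handle∈′
              (cong (mapMaybe (λ q′ → subst Tm (+-suc j k) (app p q′))) append)
              (trans (cong (sizeB β +_) size-≡) (+-suc (sizeB β) (sizeR ρ₀)))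
              (trans (onh-openArg β ρ) (cong suc onh-≡)))
  where
  -- the handles of the argument come first, right after the root
  handle∈′ : at (suc k₀) (onhB (a β ρ₀)) ≡ just (arg ∷ handle)
  handle∈′ = at-++ˡ (map (arg ∷_) (onhR ρ₀)) _ k₀ (begin
    at k₀ (map (arg ∷_) (onhR ρ₀))      ≡⟨ at-map (arg ∷_) k₀ (onhR ρ₀) ⟩
    mapMaybe (arg ∷_) (at k₀ (onhR ρ₀)) ≡⟨ cong (mapMaybe (arg ∷_)) handle∈ ⟩
    just (arg ∷ handle)                 ∎)

foOnS : ∀ {i} {t : Tm i} {β : B t} → ShapeB.FOSplit β → ShapeR.FOSplit (s β)
foOnS (foSplit t₁ t₂ γ₁ π₂ plug size-≡ onh-≡) =
  foSplitᴿ t₁ t₂ (s γ₁) π₂ plug (cong suc size-≡) onh-≡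

onS : ∀ {i} {t : Tm i} {β : B t} → ShapeB.Shape β → ShapeR.Shape (s β)
onS identity = identityᴿ
onS (fo split) = foᴿ (foOnS split)
onS (vo (voSplit grow t₀ β₀ handle k₀ handle∈ append size-≡ onh-≡)) =
  voᴿ (voSplitᴿ grow t₀ (s β₀) handle k₀ handle∈ append (cong suc size-≡) onh-≡)

foUnderLam : ∀ {i} {t : Tm (suc (suc i))} {ρ : R t} → ShapeR.FOSplit ρ → ShapeR.FOSplit (ℓ ρ)
foUnderLam {ρ = ρ} (foSplitᴿ t₁ t₂ γ₁ π₂ plug size-≡ onh-≡) =
  foSplitᴿ (lam t₁) t₂ (ℓ γ₁) π₂ (body plug) size-≡ (begin
    length (onhR (ℓ ρ))
      ≡⟨ onh-lam ρ ⟩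
    length (onhR ρ)
      ≡⟨ onh-≡ ⟩
    suc (length (onhR γ₁) + length (onhR π₂))
      ≡⟨ cong (λ n → suc (n + length (onhR π₂))) (sym (onh-lam γ₁)) ⟩
    suc (length (onhR (ℓ γ₁)) + length (onhR π₂)) ∎)

underLam : ∀ {i} {t : Tm (suc (suc i))} (ρ : R t) → ShapeR.Shape ρ → ShapeR.Shape (ℓ ρ)
underLam ρ (foᴿ split) = foᴿ (foUnderLam split)
underLam ρ (voᴿ (voSplitᴿ refl t₀ γ₀ handle k₀ handle∈ append size-≡ onh-≡)) =
  voᴿ (voSplitᴿ refl (lam t₀) (ℓ γ₀) (body ∷ handle) k₀
        (trans (at-map (body ∷_) k₀ (onhR γ₀)) (cong (mapMaybe (body ∷_)) handle∈))
        (cong (mapMaybe lam) append) size-≡ (trans (onh-lam ρ) onh-≡))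

mutual
  decB : ∀ {i} {t : Tm i} (β : B t) → ShapeB.Shape β
  decB v                       = identity
  decB (a {k = zero} β (s β′)) = ⊥-elim (no-closed-neutral β′)
  decB (a {k = zero} β (ℓ π₂)) = closedArg β π₂ (decB β)
  decB (a {k = suc _} β ρ)     = openArg β ρ (decR ρ)

  decR : ∀ {i} {t : Tm (suc i)} (ρ : R t) → ShapeR.Shape ρ
  decR (s β) = onS (decB β)
  decR (ℓ ρ) = underLam ρ (decR ρ)

IsIdentity : (t : Tm 1) → R t → Set
IsIdentity t π = (t ≡ var) × (sizeR π ≡ 1) × (length (onhR π) ≡ 1)

IsFO : (t : Tm 1) → R t → Set
IsFO t π = ∃[ t₁ ] ∃[ t₂ ] Σ (R t₁) λ π₁ → Σ (R t₂) λ π₂ →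
  (t ≡ FO t₁ t₂)
  × (sizeR π ≡ sizeR π₁ + sizeR π₂)
  × (length (onhR π) ≡ 1 + length (onhR π₁) + length (onhR π₂))

IsVO : (t : Tm 1) → R t → Set
IsVO t π = ∃[ t₁ ] Σ (R t₁) λ π₁ → ∃[ k ] (1 ≤ k) × (k ≤ length (onhR π₁))
  × (VO k π₁ ≡ just t)
  × (sizeR π ≡ 1 + sizeR π₁)
  × (length (onhR π) ≡ k + 1)

fromFOSplit : {t : Tm 1} {π : R t} → ShapeR.FOSplit π → IsFO t π
fromFOSplit (foSplitᴿ t₁ t₂ γ₁ π₂ plug size-≡ onh-≡) =
  t₁ , t₂ , γ₁ , π₂ , plugLast-FO plug , size-≡ , onh-≡

-- A VO split of the body of λx₁ is VO_k with k the 1-indexed handle number.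
fromVOSplit : {p : Tm 2} {ρ : R p} → ShapeR.VOSplit ρ → IsVO (lam p) (ℓ ρ)
fromVOSplit {p} {ρ} (voSplitᴿ refl t₀ γ₀ handle k₀ handle∈ append size-≡ onh-≡) =
  t₀ , γ₀ , suc k₀ , s≤s z≤n , at-length k₀ (onhR γ₀) handle∈ , isVO , size-≡ , onh-≡′
  where
  isVO : VO (suc k₀) γ₀ ≡ just (lam p)
  isVO = begin
    VO (suc k₀) γ₀
      ≡⟨ cong (_>>= λ n → mapMaybe lam (appendAt n t₀)) (trans (nth₁-suc k₀ (onhR γ₀)) handle∈) ⟩
    mapMaybe lam (appendAt handle t₀)
      ≡⟨ cong (mapMaybe lam) append ⟩
    just (lam p) ∎
  onh-≡′ : length (onhR (ℓ ρ)) ≡ suc k₀ + 1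
  onh-≡′ = trans (onh-lam ρ) (trans onh-≡ (+-comm 1 (suc k₀)))

-- Exhaustiveness: decompose π itself, or the colouring of the body of the outer λ.
classify : (t : Tm 1) (π : R t) → IsIdentity t π ⊎ IsFO t π ⊎ IsVO t π
classify t (s β) with decB β
... | identity = inj₁ (refl , refl , refl)
... | fo split = inj₂ (inj₁ (fromFOSplit (foOnS split)))
... | vo (voSplit refl t₀ β₀ _ _ _ _ _ _) = ⊥-elim (no-closed-neutral β₀)
classify (lam p) (ℓ ρ) with decR ρ
... | foᴿ split = inj₂ (inj₁ (fromFOSplit (foUnderLam split)))
... | voᴿ split = inj₂ (inj₂ (fromVOSplit split))

identity-not-FO : (t : Tm 1) (π : R t) → ¬ (IsIdentity t π × IsFO t π)
identity-not-FO t π ((refl , _) , (t₁ , t₂ , _ , _ , isFO , _))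
  with trans (cong isVar isFO) (FO-isVar t₁ t₂)
... | ()

identity-not-VO : (t : Tm 1) (π : R t) → ¬ (IsIdentity t π × IsVO t π)
identity-not-VO t π ((refl , _) , (_ , π₁ , k , _ , _ , isVO , _)) with VO-lastIsArg k π₁ isVO
... | ()

FO-not-VO : (t : Tm 1) (π : R t) → ¬ (IsFO t π × IsVO t π)
FO-not-VO t π ((t₁ , t₂ , _ , _ , isFO , _) , (_ , π₁ , k , _ , _ , isVO , _))
  with trans (sym (VO-lastIsArg k π₁ isVO)) (trans (cong lastIsArg isFO) (FO-lastIsArg t₁ t₂))
... | ()

theorem4p9 : (t : Tm 1) (π : R t) →
    let
      Ci = (t ≡ var) × (sizeR π ≡ 1) × (length (onhR π) ≡ 1)
      Cii = ∃[ t₁ ] ∃[ t₂ ] Σ (R t₁) λ π₁ → Σ (R t₂) λ π₂ →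
              (t ≡ FO t₁ t₂)
              × (sizeR π ≡ sizeR π₁ + sizeR π₂)
              × (length (onhR π) ≡ 1 + length (onhR π₁) + length (onhR π₂))
      Ciii = ∃[ t₁ ] Σ (R t₁) λ π₁ → ∃[ k ] (1 ≤ k) × (k ≤ length (onhR π₁))
              × (VO k π₁ ≡ just t)
              × (sizeR π ≡ 1 + sizeR π₁)
              × (length (onhR π) ≡ k + 1)
    in (Ci ⊎ Cii ⊎ Ciii) × ¬ (Ci × Cii) × ¬ (Ci × Ciii) × ¬ (Cii × Ciii)
theorem4p9 t π = classify t π , identity-not-FO t π , identity-not-VO t π , FO-not-VO t π
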